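{- A monic, quartic, non-square-free polynomial $d(x)\in\mathbb{Z}[x]$ is Pellian over $\mathbb{Z}[x]$ if and only if it can be written as $d(x)=D(x)(x-a)^2$ with $D(x)\in\mathbb{Z}[x]$ monic, quadratic and Pellian over $\mathbb{Z}[x]$, and $a\in\mathbb{Z}$, such that there exist $F(x),G(x)\in\mathbb{Z}[x]$ with $G(x)\neq 0$, $F(x)^2-D(x)G(x)^2=1$ and $G(a)=0$. (Thus such $d(x)$ correspond to monic quadratic Pellian $D(x)\in\mathbb{Z}[x]$ admitting a solution $F(x)^2-D(x)G(x)^2=1$ over $\mathbb{Z}[x]$ in which $G(x)$ has a root in $\mathbb{Z}$.)
   Context: For a commutative ring $R$ with unity, a non-square polynomial $d(x)\in R[x]$ is called Pellian over $R[x]$ if there exist $f(x),g(x)\in R[x]$ with $g(x)\neq 0$ and $f(x)^2-d(x)g(x)^2=1$. -}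

module Defs where

open import Data.Nat as ℕ using (ℕ; zero; suc)
open import Data.Integer using (ℤ; _+_; _*_; -_; 0ℤ; 1ℤ)
open import Data.List using (List; []; _∷_; map)
open import Data.Product using (Σ; ∃; _×_; _,_)
open import Relation.Binary.PropositionalEquality using (_≡_)
open import Relation.Nullary using (¬_)

-- Polynomials in ℤ[x] as coefficient lists, lowest degree first.
-- Trailing zeros are allowed; equality of polynomials is coefficientwise (_≈ₚ_).
Poly : Set
Poly = List ℤ

coeff : Poly → ℕ → ℤ
coeff []      _       = 0ℤ
coeff (a ∷ p) zero    = a
coeff (a ∷ p) (suc n) = coeff p n

infix 4 _≈ₚ_
_≈ₚ_ : Poly → Poly → Set
p ≈ₚ q = ∀ n → coeff p n ≡ coeff q n

infixl 6 _+ₚ_ _-ₚ_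
infixl 7 _*ₚ_

_+ₚ_ : Poly → Poly → Poly
[]      +ₚ q       = q
(a ∷ p) +ₚ []      = a ∷ p
(a ∷ p) +ₚ (b ∷ q) = (a + b) ∷ (p +ₚ q)

scaleₚ : ℤ → Poly → Poly
scaleₚ c p = map (c *_) p

negₚ : Poly → Poly
negₚ p = map -_ p

_-ₚ_ : Poly → Poly → Poly
p -ₚ q = p +ₚ negₚ q

_*ₚ_ : Poly → Poly → Poly
[]      *ₚ q = []
(a ∷ p) *ₚ q = scaleₚ a q +ₚ (0ℤ ∷ (p *ₚ q))

0ₚ : Poly
0ₚ = []

1ₚ : Poly
1ₚ = 1ℤ ∷ []

X-_ : ℤ → Poly
X- a = (- a) ∷ 1ℤ ∷ []

eval : Poly → ℤ → ℤ
eval []      a = 0ℤ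
eval (c ∷ p) a = c + a * eval p a

MonicOfDegree : ℕ → Poly → Set
MonicOfDegree n p = (coeff p n ≡ 1ℤ) × (∀ m → n ℕ.< m → coeff p m ≡ 0ℤ)

NonConstant : Poly → Set
NonConstant p = Σ ℕ λ m → (1 ℕ.≤ m) × ¬ (coeff p m ≡ 0ℤ)

IsSquare : Poly → Set
IsSquare p = Σ Poly λ s → p ≈ₚ s *ₚ s

NonSquarefree : Poly → Set
NonSquarefree p = Σ Poly λ h → NonConstant h × (Σ Poly λ q → p ≈ₚ (h *ₚ h) *ₚ q)

Pellian : Poly → Set
Pellian d = ¬ IsSquare d ×
  (Σ Poly λ f → Σ Poly λ g → ¬ (g ≈ₚ 0ₚ) × (f *ₚ f -ₚ d *ₚ (g *ₚ g) ≈ₚ 1ₚ))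

-- Write d = h² q with h non-constant. Comparing leading terms gives lc(h)² lc(q) = 1 and
-- 2 deg h + deg q = 4; deg h = 2 would make d = h² a square, so h = ±(x - r) and q is monic
-- quadratic with d = q (x - r)². Whenever d = D s² with s ≠ 0, (f, g) solves f² - d g² = 1
-- iff (f, s g) solves f² - D G² = 1; for s = x - a the factor theorem identifies the
-- solutions (F, G) of D arising this way as those with G(a) = 0. Non-squareness passes from
-- d to D trivially, and back because a square root of D (x - a)² vanishes at a, hence is
-- divisible by x - a, and ℤ[x] has no zero divisors.

{-# OPTIONS --safe #-}
module Submission where

open import Defs
open import Algebra.Bundles using (CommutativeRing)
import Algebra.Properties.Ring
open import Data.Empty using (⊥-elim)
open import Data.Integer as ℤ using (ℤ; 0ℤ; 1ℤ; -1ℤ; _+_; _*_; -_)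
import Data.Integer.Properties as ℤ
open import Data.Integer.Tactic.RingSolver using (solve-∀)
open import Data.List using ([]; _∷_)
open import Data.Maybe using (nothing)
open import Data.Nat as ℕ using (ℕ; zero; suc; s≤s; z≤n)
import Data.Nat.Properties as ℕ
open import Data.Product using (Σ; ∃₂; _×_; _,_)
open import Data.Sum using (_⊎_; inj₁; inj₂; [_,_]′)
open import Function.Base using (_∘_; id)
open import Function.Bundles using (_⇔_; mk⇔; module Equivalence)
open import Level using (0ℓ)
open import Relation.Binary.Bundles using (Setoid)
open import Relation.Binary.Definitions using (tri<; tri≈; tri>)
open import Relation.Binary.PropositionalEquality
import Relation.Binary.Reasoning.Setoid
open import Relation.Nullary using (¬_; yes; no)
import Tactic.RingSolver as ℤ[x]-Solver
open import Tactic.RingSolver.Core.AlmostCommutativeRing using (AlmostCommutativeRing; fromCommutativeRing)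

open Equivalence using (to; from)

-- _≈ₚ_ is a function type, so p and q cannot be recovered from a proof of p ≈ₚ q;
-- wrapping it in a record makes them inferable.
infix 4 _≋_
record _≋_ (p q : Poly) : Set where
  constructor mk≋
  field coeff≡ : p ≈ₚ q
open _≋_

≋-setoid : Setoid 0ℓ 0ℓ
≋-setoid = record
  { Carrier = Poly
  ; _≈_ = _≋_
  ; isEquivalence = record
    { refl = mk≋ λ _ → refl
    ; sym = λ e → mk≋ λ n → sym (coeff≡ e n)
    ; trans = λ e f → mk≋ λ n → trans (coeff≡ e n) (coeff≡ f n)
    }
  }

open Setoid ≋-setoid using () renaming (refl to ≋-refl; sym to ≋-sym; trans to ≋-trans)
module ≋-Reasoning = Relation.Binary.Reasoning.Setoid ≋-setoid

-- The ring ℤ[x]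

coeff-+ : ∀ p q n → coeff (p +ₚ q) n ≡ coeff p n + coeff q n
coeff-+ []      q       n       = sym (ℤ.+-identityˡ _)
coeff-+ (a ∷ p) []      n       = sym (ℤ.+-identityʳ _)
coeff-+ (a ∷ p) (b ∷ q) zero    = refl
coeff-+ (a ∷ p) (b ∷ q) (suc n) = coeff-+ p q n

coeff-scale : ∀ c p n → coeff (scaleₚ c p) n ≡ c * coeff p n
coeff-scale c []      n       = sym (ℤ.*-zeroʳ c)
coeff-scale c (a ∷ p) zero    = refl
coeff-scale c (a ∷ p) (suc n) = coeff-scale c p n

coeff-neg : ∀ p n → coeff (negₚ p) n ≡ - coeff p n
coeff-neg []      n       = refl
coeff-neg (a ∷ p) zero    = refl
coeff-neg (a ∷ p) (suc n) = coeff-neg p n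

∷-cong : ∀ {a b p q} → a ≡ b → p ≋ q → a ∷ p ≋ b ∷ q
∷-cong a≡b p≋q = mk≋ λ { zero → a≡b ; (suc n) → coeff≡ p≋q n }

0∷0≋0 : 0ℤ ∷ [] ≋ 0ₚ
0∷0≋0 = mk≋ λ { zero → refl ; (suc n) → refl }

+-cong : ∀ {p p′ q q′} → p ≋ p′ → q ≋ q′ → p +ₚ q ≋ p′ +ₚ q′
+-cong {p} {p′} {q} {q′} e f = mk≋ λ n → begin
  coeff (p +ₚ q) n         ≡⟨ coeff-+ p q n ⟩
  coeff p n + coeff q n    ≡⟨ cong₂ _+_ (coeff≡ e n) (coeff≡ f n) ⟩
  coeff p′ n + coeff q′ n  ≡⟨ coeff-+ p′ q′ n ⟨
  coeff (p′ +ₚ q′) n       ∎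
  where open ≡-Reasoning

+-assoc : ∀ p q r → (p +ₚ q) +ₚ r ≋ p +ₚ (q +ₚ r)
+-assoc p q r = mk≋ λ n → begin
  coeff ((p +ₚ q) +ₚ r) n                 ≡⟨ trans (coeff-+ (p +ₚ q) r n) (cong (_+ coeff r n) (coeff-+ p q n)) ⟩
  coeff p n + coeff q n + coeff r n       ≡⟨ ℤ.+-assoc (coeff p n) (coeff q n) (coeff r n) ⟩
  coeff p n + (coeff q n + coeff r n)     ≡⟨ trans (coeff-+ p (q +ₚ r) n) (cong (coeff p n +_) (coeff-+ q r n)) ⟨
  coeff (p +ₚ (q +ₚ r)) n                 ∎
  where open ≡-Reasoning

+-comm : ∀ p q → p +ₚ q ≋ q +ₚ p
+-comm p q = mk≋ λ n → trans (coeff-+ p q n) (trans (ℤ.+-comm (coeff p n) _) (sym (coeff-+ q p n)))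

+-identityʳ : ∀ p → p +ₚ 0ₚ ≋ p
+-identityʳ p = mk≋ λ n → trans (coeff-+ p [] n) (ℤ.+-identityʳ (coeff p n))

-‿inverseʳ : ∀ p → p +ₚ negₚ p ≋ 0ₚ
-‿inverseʳ p = mk≋ λ n →
  trans (coeff-+ p (negₚ p) n) (trans (cong (coeff p n +_) (coeff-neg p n)) (ℤ.+-inverseʳ (coeff p n)))

neg-cong : ∀ {p q} → p ≋ q → negₚ p ≋ negₚ q
neg-cong {p} {q} e = mk≋ λ n → trans (coeff-neg p n) (trans (cong -_ (coeff≡ e n)) (sym (coeff-neg q n)))

scale-cong : ∀ c {p q} → p ≋ q → scaleₚ c p ≋ scaleₚ c q
scale-cong c {p} {q} e = mk≋ λ n →
  trans (coeff-scale c p n) (trans (cong (c *_) (coeff≡ e n)) (sym (coeff-scale c q n)))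

scale-+ : ∀ c p q → scaleₚ c (p +ₚ q) ≋ scaleₚ c p +ₚ scaleₚ c q
scale-+ c p q = mk≋ λ n → begin
  coeff (scaleₚ c (p +ₚ q)) n       ≡⟨ trans (coeff-scale c (p +ₚ q) n) (cong (c *_) (coeff-+ p q n)) ⟩
  c * (coeff p n + coeff q n)        ≡⟨ ℤ.*-distribˡ-+ c (coeff p n) (coeff q n) ⟩
  c * coeff p n + c * coeff q n      ≡⟨ trans (coeff-+ (scaleₚ c p) (scaleₚ c q) n)
                                              (cong₂ _+_ (coeff-scale c p n) (coeff-scale c q n)) ⟨
  coeff (scaleₚ c p +ₚ scaleₚ c q) n ∎
  where open ≡-Reasoning

scale-scale : ∀ a b p → scaleₚ a (scaleₚ b p) ≋ scaleₚ b (scaleₚ a p)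
scale-scale a b p = mk≋ λ n → begin
  coeff (scaleₚ a (scaleₚ b p)) n ≡⟨ trans (coeff-scale a (scaleₚ b p) n) (cong (a *_) (coeff-scale b p n)) ⟩
  a * (b * coeff p n)             ≡⟨ swap a b (coeff p n) ⟩
  b * (a * coeff p n)             ≡⟨ trans (coeff-scale b (scaleₚ a p) n) (cong (b *_) (coeff-scale a p n)) ⟨
  coeff (scaleₚ b (scaleₚ a p)) n ∎
  where
  open ≡-Reasoning
  swap : ∀ x y z → x * (y * z) ≡ y * (x * z)
  swap = solve-∀

scale-1 : ∀ p → scaleₚ 1ℤ p ≋ p
scale-1 p = mk≋ λ n → trans (coeff-scale 1ℤ p n) (ℤ.*-identityˡ (coeff p n))

scale-0∷ : ∀ c p → scaleₚ c (0ℤ ∷ p) ≋ 0ℤ ∷ scaleₚ c p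
scale-0∷ c p = ∷-cong (ℤ.*-zeroʳ c) ≋-refl

*-congˡ : ∀ p {q q′} → q ≋ q′ → p *ₚ q ≋ p *ₚ q′
*-congˡ []      e = ≋-refl
*-congˡ (a ∷ p) e = +-cong (scale-cong a e) (∷-cong refl (*-congˡ p e))

*-zeroʳ : ∀ p → p *ₚ 0ₚ ≋ 0ₚ
*-zeroʳ []      = ≋-refl
*-zeroʳ (a ∷ p) = ≋-trans (∷-cong refl (*-zeroʳ p)) 0∷0≋0

*-∷ʳ : ∀ p a q → p *ₚ (a ∷ q) ≋ scaleₚ a p +ₚ (0ℤ ∷ p *ₚ q)
*-∷ʳ []      a q = ≋-sym 0∷0≋0
*-∷ʳ (b ∷ p) a q = ∷-cong (head b a) (begin
  scaleₚ b q +ₚ (p *ₚ (a ∷ q))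
    ≈⟨ +-cong ≋-refl (*-∷ʳ p a q) ⟩
  scaleₚ b q +ₚ (scaleₚ a p +ₚ (0ℤ ∷ p *ₚ q))
    ≈⟨ ≋-sym (+-assoc (scaleₚ b q) (scaleₚ a p) _) ⟩
  (scaleₚ b q +ₚ scaleₚ a p) +ₚ (0ℤ ∷ p *ₚ q)
    ≈⟨ +-cong (+-comm (scaleₚ b q) (scaleₚ a p)) ≋-refl ⟩
  (scaleₚ a p +ₚ scaleₚ b q) +ₚ (0ℤ ∷ p *ₚ q)
    ≈⟨ +-assoc (scaleₚ a p) (scaleₚ b q) _ ⟩
  scaleₚ a p +ₚ (b ∷ p) *ₚ q ∎)
  where
  open ≋-Reasoning
  head : ∀ x y → x * y + 0ℤ ≡ y * x + 0ℤ
  head = solve-∀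

*-comm : ∀ p q → p *ₚ q ≋ q *ₚ p
*-comm []      q = ≋-sym (*-zeroʳ q)
*-comm (a ∷ p) q = ≋-trans (+-cong ≋-refl (∷-cong refl (*-comm p q))) (≋-sym (*-∷ʳ q a p))

*-congʳ : ∀ {p p′} q → p ≋ p′ → p *ₚ q ≋ p′ *ₚ q
*-congʳ {p} {p′} q e = ≋-trans (*-comm p q) (≋-trans (*-congˡ q e) (*-comm q p′))

*-cong : ∀ {p p′ q q′} → p ≋ p′ → q ≋ q′ → p *ₚ q ≋ p′ *ₚ q′
*-cong {p′ = p′} {q = q} e f = ≋-trans (*-congʳ q e) (*-congˡ p′ f)

+-interchange : ∀ p q r s → (p +ₚ q) +ₚ (r +ₚ s) ≋ (p +ₚ r) +ₚ (q +ₚ s)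
+-interchange p q r s = begin
  (p +ₚ q) +ₚ (r +ₚ s) ≈⟨ +-assoc p q (r +ₚ s) ⟩
  p +ₚ (q +ₚ (r +ₚ s)) ≈⟨ +-cong (≋-refl {p}) (≋-sym (+-assoc q r s)) ⟩
  p +ₚ ((q +ₚ r) +ₚ s) ≈⟨ +-cong (≋-refl {p}) (+-cong (+-comm q r) (≋-refl {s})) ⟩
  p +ₚ ((r +ₚ q) +ₚ s) ≈⟨ +-cong (≋-refl {p}) (+-assoc r q s) ⟩
  p +ₚ (r +ₚ (q +ₚ s)) ≈⟨ ≋-sym (+-assoc p r (q +ₚ s)) ⟩
  (p +ₚ r) +ₚ (q +ₚ s) ∎
  where open ≋-Reasoning

*-distribˡ-+ : ∀ p q r → p *ₚ (q +ₚ r) ≋ p *ₚ q +ₚ p *ₚ r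
*-distribˡ-+ []      q r = ≋-refl
*-distribˡ-+ (a ∷ p) q r = begin
  scaleₚ a (q +ₚ r) +ₚ (0ℤ ∷ p *ₚ (q +ₚ r))
    ≈⟨ +-cong (scale-+ a q r) (∷-cong refl (*-distribˡ-+ p q r)) ⟩
  (scaleₚ a q +ₚ scaleₚ a r) +ₚ ((0ℤ ∷ p *ₚ q) +ₚ (0ℤ ∷ p *ₚ r))
    ≈⟨ +-interchange (scaleₚ a q) (scaleₚ a r) (0ℤ ∷ p *ₚ q) (0ℤ ∷ p *ₚ r) ⟩
  (a ∷ p) *ₚ q +ₚ (a ∷ p) *ₚ r ∎
  where open ≋-Reasoning

*-distribʳ-+ : ∀ p q r → (q +ₚ r) *ₚ p ≋ q *ₚ p +ₚ r *ₚ p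
*-distribʳ-+ p q r =
  ≋-trans (*-comm (q +ₚ r) p) (≋-trans (*-distribˡ-+ p q r) (+-cong (*-comm p q) (*-comm p r)))

*-scaleʳ : ∀ c p q → p *ₚ scaleₚ c q ≋ scaleₚ c (p *ₚ q)
*-scaleʳ c []      q = ≋-refl
*-scaleʳ c (a ∷ p) q = begin
  scaleₚ a (scaleₚ c q) +ₚ (0ℤ ∷ p *ₚ scaleₚ c q)
    ≈⟨ +-cong (scale-scale a c q) (≋-trans (∷-cong refl (*-scaleʳ c p q)) (≋-sym (scale-0∷ c (p *ₚ q)))) ⟩
  scaleₚ c (scaleₚ a q) +ₚ scaleₚ c (0ℤ ∷ p *ₚ q)
    ≈⟨ ≋-sym (scale-+ c (scaleₚ a q) (0ℤ ∷ p *ₚ q)) ⟩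
  scaleₚ c ((a ∷ p) *ₚ q) ∎
  where open ≋-Reasoning

*-assoc : ∀ p q r → (p *ₚ q) *ₚ r ≋ p *ₚ (q *ₚ r)
*-assoc []      q r = ≋-refl
*-assoc (a ∷ p) q r = begin
  (scaleₚ a q +ₚ (0ℤ ∷ p *ₚ q)) *ₚ r
    ≈⟨ *-distribʳ-+ r (scaleₚ a q) (0ℤ ∷ p *ₚ q) ⟩
  scaleₚ a q *ₚ r +ₚ (0ℤ ∷ p *ₚ q) *ₚ r
    ≈⟨ +-cong (≋-trans (*-comm (scaleₚ a q) r) (*-scaleʳ a r q)) (+-cong (scale-0 r) ≋-refl) ⟩
  scaleₚ a (r *ₚ q) +ₚ (0ℤ ∷ (p *ₚ q) *ₚ r)
    ≈⟨ +-cong (scale-cong a (*-comm r q)) (∷-cong refl (*-assoc p q r)) ⟩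
  (a ∷ p) *ₚ (q *ₚ r) ∎
  where
  open ≋-Reasoning
  scale-0 : ∀ p → scaleₚ 0ℤ p ≋ 0ₚ
  scale-0 p = mk≋ λ n → trans (coeff-scale 0ℤ p n) (ℤ.*-zeroˡ (coeff p n))

*-identityˡ : ∀ p → 1ₚ *ₚ p ≋ p
*-identityˡ p = ≋-trans (+-cong (scale-1 p) 0∷0≋0) (+-identityʳ p)

*-identityʳ : ∀ p → p *ₚ 1ₚ ≋ p
*-identityʳ p = ≋-trans (*-comm p 1ₚ) (*-identityˡ p)

ℤ[x] : CommutativeRing 0ℓ 0ℓ
ℤ[x] = record
  { Carrier = Poly ; _≈_ = _≋_ ; _+_ = _+ₚ_ ; _*_ = _*ₚ_ ; -_ = negₚ ; 0# = 0ₚ ; 1# = 1ₚ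
  ; isCommutativeRing = record
    { isRing = record
      { +-isAbelianGroup = record
        { isGroup = record
          { isMonoid = record
            { isSemigroup = record
              { isMagma = record { isEquivalence = Setoid.isEquivalence ≋-setoid ; ∙-cong = +-cong }
              ; assoc = +-assoc }
            ; identity = (λ _ → ≋-refl) , +-identityʳ }
          ; inverse = (λ p → ≋-trans (+-comm (negₚ p) p) (-‿inverseʳ p)) , -‿inverseʳ
          ; ⁻¹-cong = neg-cong }
        ; comm = +-comm }
      ; *-cong = *-cong
      ; *-assoc = *-assoc
      ; *-identity = *-identityˡ , *-identityʳ
      ; distrib = *-distribˡ-+ , *-distribʳ-+ }
    ; *-comm = *-comm }
  }

ℤ[x]ₐ : AlmostCommutativeRing 0ℓ 0ℓ
ℤ[x]ₐ = fromCommutativeRing ℤ[x] (λ _ → nothing)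

open Algebra.Properties.Ring (CommutativeRing.ring ℤ[x]) using (x∙y⁻¹≈ε⇒x≈y; x≈y⇒x∙y⁻¹≈ε; [y-z]x≈yx-zx)

-- Degrees

record Leading (p : Poly) (n : ℕ) (c : ℤ) : Set where
  constructor leading
  field
    coeff-leading : coeff p n ≡ c
    leading≢0     : ¬ c ≡ 0ℤ
    coeff-above   : ∀ m → n ℕ.< m → coeff p m ≡ 0ℤ
open Leading

≋0⊎leading : ∀ p → p ≋ 0ₚ ⊎ ∃₂ (Leading p)
≋0⊎leading []      = inj₁ ≋-refl
≋0⊎leading (a ∷ p) with ≋0⊎leading p
... | inj₂ (n , c , leading lead c≢0 above) =
  inj₂ (suc n , c , leading lead c≢0 λ { (suc m) (s≤s n<m) → above m n<m })
... | inj₁ p≋0 with a ℤ.≟ 0ℤ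
...   | yes a≡0 = inj₁ (mk≋ λ { zero → a≡0 ; (suc m) → coeff≡ p≋0 m })
...   | no  a≢0 = inj₂ (0 , a , leading refl a≢0 λ { (suc m) _ → coeff≡ p≋0 m })

leading-cong : ∀ {p q n c} → p ≋ q → Leading p n c → Leading q n c
leading-cong e (leading lead c≢0 above) =
  leading (trans (sym (coeff≡ e _)) lead) c≢0 λ m n<m → trans (sym (coeff≡ e m)) (above m n<m)

leading⇒≉0 : ∀ {p n c} → Leading p n c → ¬ p ≋ 0ₚ
leading⇒≉0 {n = n} (leading lead c≢0 _) p≋0 = c≢0 (trans (sym lead) (coeff≡ p≋0 n))

leading⇒degree-bound : ∀ {p n c} → Leading p n c → ∀ m → ¬ coeff p m ≡ 0ℤ → m ℕ.≤ n
leading⇒degree-bound {n = n} l m pₘ≢0 with m ℕ.≤? n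
... | yes m≤n = m≤n
... | no  m≰n = ⊥-elim (pₘ≢0 (coeff-above l m (ℕ.≰⇒> m≰n)))

leading-unique : ∀ {p n c n′ c′} → Leading p n c → Leading p n′ c′ → n ≡ n′ × c ≡ c′
leading-unique {n = n} {n′ = n′} l l′ with ℕ.<-cmp n n′
... | tri< n<n′ _ _ = ⊥-elim (leading≢0 l′ (trans (sym (coeff-leading l′)) (coeff-above l n′ n<n′)))
... | tri≈ _ refl _ = refl , trans (sym (coeff-leading l)) (coeff-leading l′)
... | tri> _ _ n>n′ = ⊥-elim (leading≢0 l (trans (sym (coeff-leading l)) (coeff-above l′ n n>n′)))

leading-scale : ∀ {q n b} a → ¬ a ≡ 0ℤ → Leading q n b → Leading (scaleₚ a q) n (a * b)
leading-scale {q} {n} a a≢0 (leading lead b≢0 above) = leading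
  (trans (coeff-scale a q n) (cong (a *_) lead))
  ([ a≢0 , b≢0 ]′ ∘ ℤ.i*j≡0⇒i≡0∨j≡0 a)
  (λ m n<m → trans (coeff-scale a q m) (trans (cong (a *_) (above m n<m)) (ℤ.*-zeroʳ a)))

leading-* : ∀ {p q m n a b} → Leading p m a → Leading q n b → Leading (p *ₚ q) (m ℕ.+ n) (a * b)
leading-* {[]} l _ = ⊥-elim (leading≢0 l (sym (coeff-leading l)))
leading-* {a₀ ∷ p} {q} {zero} {n} {a} l lq = leading-cong (≋-sym a₀∷p*q≋a₀q) (leading-scale a (leading≢0 l) lq)
  where
  p≋0 : p ≋ 0ₚ
  p≋0 = mk≋ λ k → coeff-above l (suc k) (s≤s z≤n)
  a₀∷p*q≋a₀q : (a₀ ∷ p) *ₚ q ≋ scaleₚ a q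
  a₀∷p*q≋a₀q rewrite coeff-leading l =
    ≋-trans (+-cong (≋-refl {scaleₚ a q}) (≋-trans (∷-cong refl (*-congʳ q p≋0)) 0∷0≋0)) (+-identityʳ (scaleₚ a q))
leading-* {a₀ ∷ p} {q} {suc m} {n} l lq = leading
  (trans (shifted (suc (m ℕ.+ n)) ℕ.≤-refl) (coeff-leading lp*q))
  (leading≢0 lp*q)
  (λ { (suc k) (s≤s m+n<k) → trans (shifted (suc k) (ℕ.<⇒≤ (s≤s m+n<k))) (coeff-above lp*q k m+n<k) })
  where
  lp*q : Leading (p *ₚ q) (m ℕ.+ n) _
  lp*q = leading-* {p} (leading (coeff-leading l) (leading≢0 l) λ k m<k → coeff-above l (suc k) (s≤s m<k)) lq
  -- scaleₚ a₀ q vanishes beyond the degree of q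
  shifted : ∀ k → suc (m ℕ.+ n) ℕ.≤ k → coeff ((a₀ ∷ p) *ₚ q) k ≡ coeff (0ℤ ∷ p *ₚ q) k
  shifted k m+n<k = begin
    coeff (scaleₚ a₀ q +ₚ (0ℤ ∷ p *ₚ q)) k   ≡⟨ coeff-+ (scaleₚ a₀ q) (0ℤ ∷ p *ₚ q) k ⟩
    coeff (scaleₚ a₀ q) k + coeff (0ℤ ∷ p *ₚ q) k  ≡⟨ cong (_+ coeff (0ℤ ∷ p *ₚ q) k) a₀qₖ≡0 ⟩
    0ℤ + coeff (0ℤ ∷ p *ₚ q) k               ≡⟨ ℤ.+-identityˡ _ ⟩
    coeff (0ℤ ∷ p *ₚ q) k                    ∎
    where
    open ≡-Reasoning
    a₀qₖ≡0 : coeff (scaleₚ a₀ q) k ≡ 0ℤ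
    a₀qₖ≡0 = trans (coeff-scale a₀ q k)
      (trans (cong (a₀ *_) (coeff-above lq k (ℕ.≤-trans (s≤s (ℕ.m≤n+m n m)) m+n<k))) (ℤ.*-zeroʳ a₀))

*-≉0 : ∀ {p q} → ¬ p ≋ 0ₚ → ¬ q ≋ 0ₚ → ¬ p *ₚ q ≋ 0ₚ
*-≉0 {p} {q} p≉0 q≉0 with ≋0⊎leading p | ≋0⊎leading q
... | inj₁ p≋0 | _ = ⊥-elim (p≉0 p≋0)
... | inj₂ _ | inj₁ q≋0 = ⊥-elim (q≉0 q≋0)
... | inj₂ (_ , _ , lp) | inj₂ (_ , _ , lq) = leading⇒≉0 (leading-* lp lq)

*-cancelʳ : ∀ {p q} c → ¬ c ≋ 0ₚ → p *ₚ c ≋ q *ₚ c → p ≋ q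
*-cancelʳ {p} {q} c c≉0 pc≋qc with ≋0⊎leading (p -ₚ q)
... | inj₁ p-q≋0      = x∙y⁻¹≈ε⇒x≈y p q p-q≋0
... | inj₂ (_ , _ , l) = ⊥-elim (*-≉0 (leading⇒≉0 l) c≉0 (≋-trans ([y-z]x≈yx-zx c p q) (x≈y⇒x∙y⁻¹≈ε pc≋qc)))

X-≉0 : ∀ a → ¬ X- a ≋ 0ₚ
X-≉0 a X-a≋0 with coeff≡ X-a≋0 1
... | ()

-- Evaluation and the factor theorem

eval-+ : ∀ p q a → eval (p +ₚ q) a ≡ eval p a + eval q a
eval-+ []      q       a = sym (ℤ.+-identityˡ _)
eval-+ (c ∷ p) []      a = sym (ℤ.+-identityʳ _)
eval-+ (c ∷ p) (d ∷ q) a = trans (cong (λ x → c + d + a * x) (eval-+ p q a)) (regroup c d a (eval p a) (eval q a))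
  where
  regroup : ∀ c d a x y → c + d + a * (x + y) ≡ c + a * x + (d + a * y)
  regroup = solve-∀

eval-scale : ∀ c p a → eval (scaleₚ c p) a ≡ c * eval p a
eval-scale c []      a = sym (ℤ.*-zeroʳ c)
eval-scale c (d ∷ p) a = trans (cong (λ x → c * d + a * x) (eval-scale c p a)) (regroup c d a (eval p a))
  where
  regroup : ∀ c d a x → c * d + a * (c * x) ≡ c * (d + a * x)
  regroup = solve-∀

eval-* : ∀ p q a → eval (p *ₚ q) a ≡ eval p a * eval q a
eval-* []      q a = sym (ℤ.*-zeroˡ (eval q a))
eval-* (c ∷ p) q a = begin
  eval (scaleₚ c q +ₚ (0ℤ ∷ p *ₚ q)) a      ≡⟨ eval-+ (scaleₚ c q) (0ℤ ∷ p *ₚ q) a ⟩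
  eval (scaleₚ c q) a + (0ℤ + a * eval (p *ₚ q) a)
    ≡⟨ cong₂ (λ x y → x + (0ℤ + a * y)) (eval-scale c q a) (eval-* p q a) ⟩
  c * eval q a + (0ℤ + a * (eval p a * eval q a)) ≡⟨ regroup c a (eval p a) (eval q a) ⟩
  (c + a * eval p a) * eval q a             ∎
  where
  open ≡-Reasoning
  regroup : ∀ c a x y → c * y + (0ℤ + a * (x * y)) ≡ (c + a * x) * y
  regroup = solve-∀

eval-≋0 : ∀ {p} a → p ≋ 0ₚ → eval p a ≡ 0ℤ
eval-≋0 {[]}    a _   = refl
eval-≋0 {c ∷ p} a p≋0 = begin
  c + a * eval p a
    ≡⟨ cong₂ (λ x y → x + a * y) (coeff≡ p≋0 zero) (eval-≋0 {p} a (mk≋ λ n → coeff≡ p≋0 (suc n))) ⟩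
  0ℤ + a * 0ℤ      ≡⟨ trans (ℤ.+-identityˡ (a * 0ℤ)) (ℤ.*-zeroʳ a) ⟩
  0ℤ               ∎
  where open ≡-Reasoning

eval-cong : ∀ {p q} a → p ≋ q → eval p a ≡ eval q a
eval-cong {[]}    {q}     a e = sym (eval-≋0 a (≋-sym e))
eval-cong {c ∷ p} {[]}    a e = eval-≋0 a e
eval-cong {c ∷ p} {d ∷ q} a e =
  cong₂ (λ x y → x + a * y) (coeff≡ e zero) (eval-cong {p} {q} a (mk≋ λ n → coeff≡ e (suc n)))

eval-X- : ∀ a → eval (X- a) a ≡ 0ℤ
eval-X- = identity
  where
  identity : ∀ a → - a + a * (1ℤ + a * 0ℤ) ≡ 0ℤ
  identity = solve-∀

eval-X-*≡0 : ∀ a g → eval ((X- a) *ₚ g) a ≡ 0ℤ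
eval-X-*≡0 a g = trans (eval-* (X- a) g a) (trans (cong (_* eval g a) (eval-X- a)) (ℤ.*-zeroˡ (eval g a)))

X-*≋scale+shift : ∀ a q → (X- a) *ₚ q ≋ scaleₚ (- a) q +ₚ (0ℤ ∷ q)
X-*≋scale+shift a q = +-cong (≋-refl {scaleₚ (- a) q}) (∷-cong refl (*-identityˡ q))

quotient : ℤ → Poly → Poly
quotient a []      = []
quotient a (c ∷ p) = eval p a ∷ quotient a p

remainder-theorem : ∀ a p → p ≋ (X- a) *ₚ quotient a p +ₚ (eval p a ∷ [])
remainder-theorem a []      = mk≋ λ { zero → refl ; (suc zero) → refl ; (suc (suc n)) → refl }
remainder-theorem a (c ∷ p) = ≋-sym (begin
  (X- a) *ₚ (r ∷ Q) +ₚ ((c + a * r) ∷ [])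
    ≈⟨ +-cong (X-*≋scale+shift a (r ∷ Q)) (≋-refl {(c + a * r) ∷ []}) ⟩
  (scaleₚ (- a) (r ∷ Q) +ₚ (0ℤ ∷ r ∷ Q)) +ₚ ((c + a * r) ∷ [])
    ≈⟨ ∷-cong (cancel a c r) (begin
         (scaleₚ (- a) Q +ₚ (r ∷ Q)) +ₚ []     ≈⟨ +-identityʳ _ ⟩
         scaleₚ (- a) Q +ₚ (r ∷ Q)             ≈⟨ +-cong (≋-refl {scaleₚ (- a) Q}) r∷Q≋ ⟩
         scaleₚ (- a) Q +ₚ ((0ℤ ∷ Q) +ₚ (r ∷ [])) ≈⟨ ≋-sym (+-assoc (scaleₚ (- a) Q) (0ℤ ∷ Q) (r ∷ [])) ⟩
         (scaleₚ (- a) Q +ₚ (0ℤ ∷ Q)) +ₚ (r ∷ []) ≈⟨ +-cong (≋-sym (X-*≋scale+shift a Q)) (≋-refl {r ∷ []}) ⟩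
         (X- a) *ₚ Q +ₚ (r ∷ [])                ≈⟨ ≋-sym (remainder-theorem a p) ⟩
         p                                      ∎) ⟩
  c ∷ p ∎)
  where
  open ≋-Reasoning
  Q = quotient a p
  r = eval p a
  cancel : ∀ a c r → - a * r + 0ℤ + (c + a * r) ≡ c
  cancel = solve-∀
  r∷Q≋ : r ∷ Q ≋ (0ℤ ∷ Q) +ₚ (r ∷ [])
  r∷Q≋ = ∷-cong (sym (ℤ.+-identityˡ r)) (≋-sym (+-identityʳ Q))

factor-theorem : ∀ {p a} → eval p a ≡ 0ℤ → p ≋ (X- a) *ₚ quotient a p
factor-theorem {p} {a} p[a]≡0 = begin
  p                                            ≈⟨ remainder-theorem a p ⟩
  (X- a) *ₚ quotient a p +ₚ (eval p a ∷ [])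
    ≈⟨ +-cong (≋-refl {(X- a) *ₚ quotient a p}) (≋-trans (∷-cong p[a]≡0 ≋-refl) 0∷0≋0) ⟩
  (X- a) *ₚ quotient a p +ₚ 0ₚ                 ≈⟨ +-identityʳ _ ⟩
  (X- a) *ₚ quotient a p                       ∎
  where open ≋-Reasoning

-- Square factors of a monic quartic

∣i∣≡1⇒i≡±1 : ∀ i → ℤ.∣ i ∣ ≡ 1 → i ≡ 1ℤ ⊎ i ≡ -1ℤ
∣i∣≡1⇒i≡±1 (ℤ.+ 1)     _ = inj₁ refl
∣i∣≡1⇒i≡±1 ℤ.-[1+ 0 ]  _ = inj₂ refl

i*j≡1⇒j≡±1 : ∀ i j → i * j ≡ 1ℤ → j ≡ 1ℤ ⊎ j ≡ -1ℤ
i*j≡1⇒j≡±1 i j e = ∣i∣≡1⇒i≡±1 j (ℕ.m*n≡1⇒n≡1 ℤ.∣ i ∣ ℤ.∣ j ∣ (trans (sym (ℤ.abs-* i j)) (cong ℤ.∣_∣ e)))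

i*i*j≡1⇒j≡1∧i≡±1 : ∀ i j → i * i * j ≡ 1ℤ → j ≡ 1ℤ × (i ≡ 1ℤ ⊎ i ≡ -1ℤ)
i*i*j≡1⇒j≡1∧i≡±1 i j e
  with i*j≡1⇒j≡±1 (i * i) j e
     | i*j≡1⇒j≡±1 (i * j) i (trans (ℤ.*-comm (i * j) i) (trans (sym (ℤ.*-assoc i i j)) e))
... | inj₁ j≡1 | i≡±1     = j≡1 , i≡±1
i*i*j≡1⇒j≡1∧i≡±1 _ _ () | inj₂ refl | inj₁ refl
i*i*j≡1⇒j≡1∧i≡±1 _ _ () | inj₂ refl | inj₂ refl

monic⇒leading : ∀ {n p} → MonicOfDegree n p → Leading p n 1ℤ
monic⇒leading (lead , above) = leading lead (λ ()) above

degree-split : ∀ {k j} → 1 ℕ.≤ k → k ℕ.+ k ℕ.+ j ≡ 4 → (k ≡ 1 × j ≡ 2) ⊎ (k ≡ 2 × j ≡ 0)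
degree-split {1} _ refl = inj₁ (refl , refl)
degree-split {2} _ refl = inj₂ (refl , refl)
degree-split {suc (suc (suc k))} {j} _ e = ⊥-elim (ℕ.<⇒≢ 4<k+k+j (sym e))
  where
  4<k+k+j : 4 ℕ.< suc (suc (suc k)) ℕ.+ suc (suc (suc k)) ℕ.+ j
  4<k+k+j = ℕ.≤-trans (ℕ.n≤1+n 5) (ℕ.≤-trans (ℕ.+-mono-≤ (ℕ.m≤m+n 3 k) (ℕ.m≤m+n 3 k)) (ℕ.m≤m+n _ j))

leading-0⇒≋const : ∀ {q c} → Leading q 0 c → q ≋ c ∷ []
leading-0⇒≋const l = mk≋ λ { zero → coeff-leading l ; (suc m) → coeff-above l (suc m) (s≤s z≤n) }

-- With leading coefficient ±1, h = ±(x - r) for r = ∓ h(0); either way h² = (x - r)².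
leading-±1⇒square≋X-² : ∀ {h α} → Leading h 1 α → α ≡ 1ℤ ⊎ α ≡ -1ℤ → Σ ℤ λ r → h *ₚ h ≋ (X- r) *ₚ (X- r)
leading-±1⇒square≋X-² {h} l (inj₁ refl) = - coeff h 0 , *-cong h≋ h≋
  where
  h≋ : h ≋ X- (- coeff h 0)
  h≋ = mk≋ λ { zero          → sym (ℤ.neg-involutive _)
             ; (suc zero)    → coeff-leading l
             ; (suc (suc m)) → coeff-above l (suc (suc m)) (s≤s (s≤s z≤n)) }
leading-±1⇒square≋X-² {h} l (inj₂ refl) = coeff h 0 , ≋-trans (*-cong h≋ h≋) (neg-square (X- coeff h 0))
  where
  h≋ : h ≋ negₚ (X- coeff h 0)
  h≋ = mk≋ λ { zero          → sym (ℤ.neg-involutive _)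
             ; (suc zero)    → coeff-leading l
             ; (suc (suc m)) → coeff-above l (suc (suc m)) (s≤s (s≤s z≤n)) }
  neg-square : ∀ p → negₚ p *ₚ negₚ p ≋ p *ₚ p
  neg-square = ℤ[x]-Solver.solve-∀ ℤ[x]ₐ

monic-quartic-square-factor : ∀ {d h q} → ¬ IsSquare d → MonicOfDegree 4 d → NonConstant h →
  d ≋ (h *ₚ h) *ₚ q → MonicOfDegree 2 q × Σ ℤ λ r → d ≋ q *ₚ ((X- r) *ₚ (X- r))
monic-quartic-square-factor {d} {h} {q} ¬sq monic (m , 1≤m , hₘ≢0) d≋h²q
  with ≋0⊎leading h | ≋0⊎leading q
... | inj₁ h≋0 | _        = ⊥-elim (hₘ≢0 (coeff≡ h≋0 m))
... | inj₂ _   | inj₁ q≋0 =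
  ⊥-elim (leading⇒≉0 (monic⇒leading monic)
    (≋-trans d≋h²q (≋-trans (*-congˡ (h *ₚ h) q≋0) (*-zeroʳ (h *ₚ h)))))
... | inj₂ (k , α , lh) | inj₂ (j , β , lq) =
  by-degree lh lq
    (leading-unique (leading-cong (≋-sym d≋h²q) (leading-* (leading-* lh lh) lq)) (monic⇒leading monic))
    (ℕ.≤-trans 1≤m (leading⇒degree-bound lh m hₘ≢0))
  where
  by-degree : ∀ {k j α β} → Leading h k α → Leading q j β → k ℕ.+ k ℕ.+ j ≡ 4 × α * α * β ≡ 1ℤ → 1 ℕ.≤ k →
    MonicOfDegree 2 q × Σ ℤ λ r → d ≋ q *ₚ ((X- r) *ₚ (X- r))
  by-degree {α = α} {β = β} lh lq (2k+j≡4 , α²β≡1) 1≤k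
    with degree-split 1≤k 2k+j≡4 | i*i*j≡1⇒j≡1∧i≡±1 α β α²β≡1
  ... | inj₁ (refl , refl) | refl , α≡±1 =
    let r , h²≋X-r² = leading-±1⇒square≋X-² lh α≡±1
    in (coeff-leading lq , coeff-above lq) , r , ≋-trans d≋h²q (≋-trans (*-congʳ q h²≋X-r²) (*-comm _ q))
  ... | inj₂ (refl , refl) | refl , _ =
    ⊥-elim (¬sq (h , coeff≡ (≋-trans d≋h²q
      (≋-trans (*-congˡ (h *ₚ h) (leading-0⇒≋const lq)) (*-identityʳ (h *ₚ h))))))

-- Pell solutions across a square factor

PellSolution : Poly → Poly → Poly → Set
PellSolution d f g = ¬ (g ≈ₚ 0ₚ) × (f *ₚ f -ₚ d *ₚ (g *ₚ g) ≈ₚ 1ₚ)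

pellSolution-⇔ : ∀ {d D s f g G} → ¬ s ≋ 0ₚ → d ≋ D *ₚ (s *ₚ s) → G ≋ s *ₚ g →
  PellSolution d f g ⇔ PellSolution D f G
pellSolution-⇔ {d} {D} {s} {f} {g} {G} s≉0 d≋Ds² G≋sg = mk⇔
  (λ (g≉0 , pell) → (λ G≈0 → *-≉0 s≉0 (g≉0 ∘ coeff≡) (≋-trans (≋-sym G≋sg) (mk≋ G≈0))) ,
                    coeff≡ (≋-trans (≋-sym same-equation) (mk≋ {q = 1ₚ} pell)))
  (λ (G≉0 , pell) → (λ g≈0 → G≉0 (coeff≡ (≋-trans G≋sg (≋-trans (*-congˡ s (mk≋ g≈0)) (*-zeroʳ s))))) ,
                    coeff≡ (≋-trans same-equation (mk≋ {q = 1ₚ} pell)))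
  where
  regroup : ∀ D s g → (D *ₚ (s *ₚ s)) *ₚ (g *ₚ g) ≋ D *ₚ ((s *ₚ g) *ₚ (s *ₚ g))
  regroup = ℤ[x]-Solver.solve-∀ ℤ[x]ₐ
  same-equation : f *ₚ f -ₚ d *ₚ (g *ₚ g) ≋ f *ₚ f -ₚ D *ₚ (G *ₚ G)
  same-equation = +-cong (≋-refl {f *ₚ f}) (neg-cong (begin
    d *ₚ (g *ₚ g)                   ≈⟨ *-congʳ (g *ₚ g) d≋Ds² ⟩
    (D *ₚ (s *ₚ s)) *ₚ (g *ₚ g)     ≈⟨ regroup D s g ⟩
    D *ₚ ((s *ₚ g) *ₚ (s *ₚ g))     ≈⟨ *-congˡ D (*-cong (≋-sym G≋sg) (≋-sym G≋sg)) ⟩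
    D *ₚ (G *ₚ G)                   ∎))
    where open ≋-Reasoning

isSquare-*-square : ∀ {d D} s → d ≋ D *ₚ (s *ₚ s) → IsSquare D → IsSquare d
isSquare-*-square {d} {D} s d≋Ds² (t , D≈t²) = t *ₚ s , coeff≡ (begin
  d                        ≈⟨ d≋Ds² ⟩
  D *ₚ (s *ₚ s)            ≈⟨ *-congʳ (s *ₚ s) (mk≋ {D} {t *ₚ t} D≈t²) ⟩
  (t *ₚ t) *ₚ (s *ₚ s)     ≈⟨ regroup t s ⟩
  (t *ₚ s) *ₚ (t *ₚ s)     ∎)
  where
  open ≋-Reasoning
  regroup : ∀ t s → (t *ₚ t) *ₚ (s *ₚ s) ≋ (t *ₚ s) *ₚ (t *ₚ s)
  regroup = ℤ[x]-Solver.solve-∀ ℤ[x]ₐ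

isSquare-cancel-X-² : ∀ {d D} a → d ≋ D *ₚ ((X- a) *ₚ (X- a)) → IsSquare d → IsSquare D
isSquare-cancel-X-² {d} {D} a d≋DX² (t , d≈t²) =
  T , coeff≡ (*-cancelʳ {D} {T *ₚ T} ((X- a) *ₚ (X- a)) (*-≉0 (X-≉0 a) (X-≉0 a)) DX²≋T²X²)
  where
  t[a]≡0 : eval t a ≡ 0ℤ
  t[a]≡0 = [ id , id ]′ (ℤ.i*j≡0⇒i≡0∨j≡0 (eval t a) (begin
    eval t a * eval t a                        ≡⟨ eval-* t t a ⟨
    eval (t *ₚ t) a                            ≡⟨ eval-cong a (≋-trans (≋-sym (mk≋ {d} {t *ₚ t} d≈t²)) d≋DX²) ⟩
    eval (D *ₚ ((X- a) *ₚ (X- a))) a           ≡⟨ eval-* D ((X- a) *ₚ (X- a)) a ⟩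
    eval D a * eval ((X- a) *ₚ (X- a)) a       ≡⟨ cong (eval D a *_) (eval-X-*≡0 a (X- a)) ⟩
    eval D a * 0ℤ                              ≡⟨ ℤ.*-zeroʳ (eval D a) ⟩
    0ℤ                                         ∎))
    where open ≡-Reasoning
  T = quotient a t
  DX²≋T²X² : D *ₚ ((X- a) *ₚ (X- a)) ≋ (T *ₚ T) *ₚ ((X- a) *ₚ (X- a))
  DX²≋T²X² = begin
    D *ₚ ((X- a) *ₚ (X- a))          ≈⟨ ≋-sym d≋DX² ⟩
    d                                ≈⟨ mk≋ {d} {t *ₚ t} d≈t² ⟩
    t *ₚ t                           ≈⟨ *-cong (factor-theorem {t} t[a]≡0) (factor-theorem {t} t[a]≡0) ⟩
    ((X- a) *ₚ T) *ₚ ((X- a) *ₚ T)   ≈⟨ regroup (X- a) T ⟩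
    (T *ₚ T) *ₚ ((X- a) *ₚ (X- a))   ∎
    where
    open ≋-Reasoning
    regroup : ∀ x t → (x *ₚ t) *ₚ (x *ₚ t) ≋ (t *ₚ t) *ₚ (x *ₚ x)
    regroup = ℤ[x]-Solver.solve-∀ ℤ[x]ₐ

pellian-*-X-² : ∀ {d D a F G} → ¬ IsSquare D → d ≋ D *ₚ ((X- a) *ₚ (X- a)) →
  PellSolution D F G → eval G a ≡ 0ℤ → Pellian d
pellian-*-X-² {d} {D} {a} {F} {G} ¬sqD d≋DX² sol G[a]≡0 =
  ¬sqD ∘ isSquare-cancel-X-² {d} {D} a d≋DX² , F , quotient a G ,
  from (pellSolution-⇔ {d} {D} {X- a} {F} {quotient a G} {G} (X-≉0 a) d≋DX² (factor-theorem {G} G[a]≡0)) sol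

lemma3p1 : (d : Poly) → MonicOfDegree 4 d → NonSquarefree d →
    (Pellian d ⇔
      (Σ Poly λ D → Σ ℤ λ a →
        MonicOfDegree 2 D × Pellian D × (d ≈ₚ D *ₚ ((X- a) *ₚ (X- a))) ×
        (Σ Poly λ F → Σ Poly λ G →
          ¬ (G ≈ₚ 0ₚ) × (F *ₚ F -ₚ D *ₚ (G *ₚ G) ≈ₚ 1ₚ) × (eval G a ≡ 0ℤ))))
lemma3p1 d monic (h , nonconstant , q , d≈h²q) = mk⇔
  (λ (¬sq , f , g , sol) →
    let q-monic , r , d≋qX² = monic-quartic-square-factor {d} {h} {q} ¬sq monic nonconstant (mk≋ d≈h²q)
        G≉0 , pell = to (pellSolution-⇔ {d} {q} {X- r} {f} {g} (X-≉0 r) d≋qX² ≋-refl) sol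
    in q , r , q-monic , (¬sq ∘ isSquare-*-square {d} {q} (X- r) d≋qX² , f , (X- r) *ₚ g , G≉0 , pell) ,
       coeff≡ d≋qX² , f , (X- r) *ₚ g , G≉0 , pell , eval-X-*≡0 r g)
  (λ (D , a , _ , (¬sqD , _) , d≈DX² , F , G , G≉0 , pell , G[a]≡0) →
    pellian-*-X-² {d} {D} {a} {F} {G} ¬sqD (mk≋ d≈DX²) (G≉0 , pell) G[a]≡0)
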